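{- Let $k\geq 2$ be an integer, let $G$ be a connected graph for which $cc_{k}(G)$ exists, and let $H$ be a subdivision of $G$. Then $cc_{k}(H)$ exists and $cc_{k}(H)\leq cc_{k}(G)$.
   Context: All graphs are finite, simple and undirected. Subdividing an edge $uv$ means deleting it and adding a new vertex $w$ with edges $uw$ and $wv$; a subdivision of $G$ is any graph obtained from $G$ by a finite sequence of edge subdivisions. An edge-coloring (not necessarily proper) of a graph is $k$-color connecting if between every pair of distinct vertices there is a path whose edges use at least $k$ different colors. $cc_{k}(G)$ is the minimum number of colors of a $k$-color connecting edge-coloring of $G$ (it does not exist if there is none). -}

module Defs where

open import Data.Nat using (ℕ; zero; suc; _≤_)
open import Data.Fin using (Fin; zero; suc; _≟_)
open import Data.Bool using (Bool; true; false; _∧_; _∨_; not)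
open import Data.List using (List; []; _∷_; length)
open import Data.List.Relation.Unary.All using (All)
open import Data.List.Relation.Unary.Unique.Propositional using (Unique)
open import Data.List.Membership.Propositional using (_∈_)
open import Data.Product using (Σ; _×_; _,_)
open import Relation.Binary.PropositionalEquality using (_≡_; _≢_)
open import Relation.Nullary.Decidable using (⌊_⌋)

record Graph (n : ℕ) : Set where
  constructor mkGraph
  field
    adj : Fin n → Fin n → Bool
open Graph public

Edge : ∀ {n} → Graph n → Fin n → Fin n → Set
Edge G u v = adj G u v ≡ true

IsSimple : ∀ {n} → Graph n → Set
IsSimple G = (∀ u v → adj G u v ≡ adj G v u) × (∀ u → adj G u u ≡ false)

data Walk {n} (G : Graph n) : Fin n → Fin n → Set where
  nil  : ∀ {u} → Walk G u u
  cons : ∀ {u w v} → Edge G u w → Walk G w v → Walk G u v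

vertices : ∀ {n} {G : Graph n} {u v} → Walk G u v → List (Fin n)
vertices {u = u} nil = u ∷ []
vertices {u = u} (cons _ p) = u ∷ vertices p

IsPath : ∀ {n} {G : Graph n} {u v} → Walk G u v → Set
IsPath p = Unique (vertices p)

Connected : ∀ {n} → Graph n → Set
Connected G = ∀ u v → Walk G u v

EdgeColouring : ℕ → ℕ → Set
EdgeColouring n c = Fin n → Fin n → Fin c

IsSymColouring : ∀ {n c} → EdgeColouring n c → Set
IsSymColouring col = ∀ u v → col u v ≡ col v u

edgeColours : ∀ {n c} {G : Graph n} {u v} → EdgeColouring n c → Walk G u v → List (Fin c)
edgeColours col nil = []
edgeColours col (cons {u} {w} _ p) = col u w ∷ edgeColours col p

AtLeastColours : ∀ {c} → ℕ → List (Fin c) → Set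
AtLeastColours {c} k xs = Σ (List (Fin c)) λ S → Unique S × k ≤ length S × All (_∈ xs) S

KColourConnecting : ∀ {n c} → ℕ → (G : Graph n) → EdgeColouring n c → Set
KColourConnecting k G col =
  ∀ u v → u ≢ v → Σ (Walk G u v) λ p → IsPath p × AtLeastColours k (edgeColours col p)

-- G has a k-colour connecting edge-colouring using (at most) c colours
HasKCC : ∀ {n} → ℕ → Graph n → ℕ → Set
HasKCC {n} k G c = Σ (EdgeColouring n c) λ col → IsSymColouring col × KColourConnecting k G col

IsCCk : ∀ {n} → ℕ → Graph n → ℕ → Set
IsCCk k G m = HasKCC k G m × (∀ c → HasKCC k G c → m ≤ c)

-- subdividing the edge uv: new vertex is zero, old vertex a becomes suc a
subdivide : ∀ {n} → Graph n → Fin n → Fin n → Graph (suc n)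
subdivide {n} G u v = mkGraph A
  where
  eq : Fin n → Fin n → Bool
  eq a b = ⌊ a ≟ b ⌋
  isEnd : Fin n → Bool
  isEnd a = eq a u ∨ eq a v
  isUV : Fin n → Fin n → Bool
  isUV a b = (eq a u ∧ eq b v) ∨ (eq a v ∧ eq b u)
  A : Fin (suc n) → Fin (suc n) → Bool
  A zero zero = false
  A zero (suc b) = isEnd b
  A (suc a) zero = isEnd a
  A (suc a) (suc b) = adj G a b ∧ not (isUV a b)

data Subdivision {n} (G : Graph n) : ∀ {m} → Graph m → Set where
  here : Subdivision G G
  step : ∀ {m} {H : Graph m} → Subdivision G H → (u v : Fin m) → Edge H u v →
         Subdivision G (subdivide H u v)

-- Colour both halves of the subdivided edge uv with the colour of uv. A path of G lifts to H by
-- routing it through the new vertex exactly where it used uv, which keeps it a path and keeps its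
-- colours; a path from the new vertex is obtained from a path of G starting at u or at v. So each
-- subdivision step preserves k-colour connecting colourings with a given number of colours, for any
-- k and without using connectivity. Having such a colouring with c colours is decidable (search over
-- all colourings and over walks no longer than the number of vertices), so a least such c exists,
-- and it is at most cc_k(G).
module Submission where

open import Defs
open import Axiom.UniquenessOfIdentityProofs using (module Decidable⇒UIP)
open import Data.Bool as Bool using (Bool; true; false; _∧_; _∨_; not)
open import Data.Bool.Properties using (∨-comm; ∧-comm; ∨-zeroʳ)
open import Data.Fin using (Fin; zero; suc; _≟_)
open import Data.Fin.Properties using (any?; all?)
open import Data.List as List using (List; []; _∷_; _∷ʳ_; length; deduplicate)
open import Data.List.Membership.Propositional using (_∈_; _─_)
open import Data.List.Membership.Propositional.Properties using (∈-deduplicate⁺; ∈-deduplicate⁻; ∈-allFin)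
open import Data.List.Properties using (unfold-reverse; length-removeAt′; length-tabulate)
import Data.List.Relation.Binary.Permutation.Setoid as Permutation
import Data.List.Relation.Binary.Permutation.Setoid.Properties as Permutationₚ
open import Data.List.Relation.Binary.Subset.Propositional using (_⊆_)
open import Data.List.Relation.Unary.All as All using (All; []; _∷_)
open import Data.List.Relation.Unary.AllPairs using ([]; _∷_)
open import Data.List.Relation.Unary.Any using (here; there; index)
open import Data.List.Relation.Unary.Any.Properties using (reverse⁺)
open import Data.List.Relation.Unary.Unique.Propositional using (Unique)
import Data.List.Relation.Unary.Unique.DecPropositional as UniqueDec
import Data.List.Relation.Unary.Unique.DecPropositional.Properties as UniqueDecₚ
open import Data.Nat using (ℕ; zero; suc; _≤_; _<_; z≤n; s≤s; _≤?_)
open import Data.Nat.Properties using (≤-trans; <⇒≤; ≮⇒≥; n<1+n; m<n⇒m<1+n; m<1+n⇒m≤n; m<1+n⇒m<n∨m≡n)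
open import Data.Product as Product using (Σ; _×_; _,_; proj₁; proj₂)
open import Data.Sum using (_⊎_; inj₁; inj₂; [_,_]′)
open import Data.Vec.Functional using (head; tail) renaming (_∷_ to _∷ᵛ_)
open import Function using (_∘_; id)
open import Relation.Binary.PropositionalEquality
open import Relation.Nullary using (¬_; yes; no; contradiction)
open import Relation.Nullary.Decidable using (Dec; ⌊_⌋; map′; ¬?; _×-dec_; _⊎-dec_; _→-dec_)
open import Relation.Nullary.Irrelevant using (Irrelevant)

KColouredPath : ∀ {n c} → ℕ → (G : Graph n) → EdgeColouring n c → Fin n → Fin n → Set
KColouredPath k G col a b = Σ (Walk G a b) λ p → IsPath p × AtLeastColours k (edgeColours col p)

source∈vertices : ∀ {n} {G : Graph n} {a b} (p : Walk G a b) → a ∈ vertices p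
source∈vertices nil        = here refl
source∈vertices (cons _ _) = here refl

atLeastColours-⊆ : ∀ {c k} {xs ys : List (Fin c)} → xs ⊆ ys → AtLeastColours k xs → AtLeastColours k ys
atLeastColours-⊆ xs⊆ys (S , unique , k≤|S| , S⊆xs) = S , unique , k≤|S| , All.map xs⊆ys S⊆xs

edge⇒≢ : ∀ {n} {G : Graph n} → IsSimple G → ∀ {a b} → Edge G a b → a ≢ b
edge⇒≢ (_ , loopless) {a} ab refl = contradiction (trans (sym ab) (loopless a)) λ ()

module Reverse {n} {G : Graph n} (symmetric : ∀ a b → adj G a b ≡ adj G b a) where

  _▷_ : ∀ {a b c} → Walk G a b → Edge G b c → Walk G a c
  nil      ▷ e = cons e nil
  cons f p ▷ e = cons f (p ▷ e)

  reverse : ∀ {a b} → Walk G a b → Walk G b a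
  reverse nil                = nil
  reverse (cons {a} {w} e p) = reverse p ▷ trans (symmetric w a) e

  vertices-▷ : ∀ {a b c} (p : Walk G a b) (e : Edge G b c) → vertices (p ▷ e) ≡ vertices p ∷ʳ c
  vertices-▷ nil        e = refl
  vertices-▷ (cons f p) e = cong (_ ∷_) (vertices-▷ p e)

  edgeColours-▷ : ∀ {c} (col : EdgeColouring n c) {a b d} (p : Walk G a b) (e : Edge G b d) →
                  edgeColours col (p ▷ e) ≡ edgeColours col p ∷ʳ col b d
  edgeColours-▷ col nil        e = refl
  edgeColours-▷ col (cons f p) e = cong (_ ∷_) (edgeColours-▷ col p e)

  vertices-reverse : ∀ {a b} (p : Walk G a b) → vertices (reverse p) ≡ List.reverse (vertices p)
  vertices-reverse nil = refl
  vertices-reverse {a} (cons e p) = begin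
    vertices (reverse p ▷ _)           ≡⟨ vertices-▷ (reverse p) _ ⟩
    vertices (reverse p) ∷ʳ a          ≡⟨ cong (_∷ʳ a) (vertices-reverse p) ⟩
    List.reverse (vertices p) ∷ʳ a     ≡⟨ unfold-reverse a (vertices p) ⟨
    List.reverse (a ∷ vertices p)      ∎
    where open ≡-Reasoning

  edgeColours-reverse : ∀ {c} (col : EdgeColouring n c) → IsSymColouring col → ∀ {a b} (p : Walk G a b) →
                        edgeColours col (reverse p) ≡ List.reverse (edgeColours col p)
  edgeColours-reverse col col-sym nil = refl
  edgeColours-reverse col col-sym (cons {a} {w} e p) = begin
    edgeColours col (reverse p ▷ _)                  ≡⟨ edgeColours-▷ col (reverse p) _ ⟩
    edgeColours col (reverse p) ∷ʳ col w a           ≡⟨ cong₂ _∷ʳ_ (edgeColours-reverse col col-sym p) (col-sym w a) ⟩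
    List.reverse (edgeColours col p) ∷ʳ col a w      ≡⟨ unfold-reverse (col a w) (edgeColours col p) ⟨
    List.reverse (col a w ∷ edgeColours col p)       ∎
    where open ≡-Reasoning

  reverse-isPath : ∀ {a b} (p : Walk G a b) → IsPath p → IsPath (reverse p)
  reverse-isPath p unique = subst Unique (sym (vertices-reverse p))
    (Unique-resp-↭ (↭-sym (↭-reverse (vertices p))) unique)
    where open Permutation (setoid (Fin n)); open Permutationₚ (setoid (Fin n))

  reverse-kColouredPath : ∀ {c k} (col : EdgeColouring n c) → IsSymColouring col → ∀ {a b} →
                          KColouredPath k G col a b → KColouredPath k G col b a
  reverse-kColouredPath col col-sym (p , isPath , atLeast) =
    reverse p , reverse-isPath p isPath ,
    atLeastColours-⊆ (λ x∈ → subst (_ ∈_) (sym (edgeColours-reverse col col-sym p)) (reverse⁺ x∈)) atLeast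

module Subdivide {n} (G : Graph n) (u v : Fin n) where

  H : Graph (suc n)
  H = subdivide G u v

  data Ends : Fin n → Fin n → Set where
    u-v : Ends u v
    v-u : Ends v u

  isUV : Fin n → Fin n → Bool
  isUV x z = (⌊ x ≟ u ⌋ ∧ ⌊ z ≟ v ⌋) ∨ (⌊ x ≟ v ⌋ ∧ ⌊ z ≟ u ⌋)

  -- Stated with isUV unfolded, so that `with` can abstract over the four decisions.
  isUV⇒Ends : ∀ x z → (⌊ x ≟ u ⌋ ∧ ⌊ z ≟ v ⌋) ∨ (⌊ x ≟ v ⌋ ∧ ⌊ z ≟ u ⌋) ≡ true → Ends x z
  isUV⇒Ends x z eq with x ≟ u | z ≟ v | x ≟ v | z ≟ u | eq
  ... | yes refl | yes refl | _        | _        | _  = u-v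
  ... | _        | _        | yes refl | yes refl | _  = v-u
  ... | no _     | _        | no _     | _        | ()
  ... | no _     | _        | yes _    | no _     | ()
  ... | yes _    | no _     | no _     | _        | ()
  ... | yes _    | no _     | yes _    | no _     | ()

  isUV-sym : ∀ x z → isUV x z ≡ isUV z x
  isUV-sym x z = trans (∨-comm (⌊ x ≟ u ⌋ ∧ ⌊ z ≟ v ⌋) _)
                       (cong₂ _∨_ (∧-comm ⌊ x ≟ v ⌋ _) (∧-comm ⌊ x ≟ u ⌋ _))

  isSimple : IsSimple G → IsSimple H
  isSimple (symmetric , loopless) = symmetricH , looplessH
    where
    symmetricH : ∀ a b → adj H a b ≡ adj H b a
    symmetricH zero    zero    = refl
    symmetricH zero    (suc b) = refl
    symmetricH (suc a) zero    = refl
    symmetricH (suc a) (suc b) = cong₂ (λ e s → e ∧ not s) (symmetric a b) (isUV-sym a b)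
    looplessH : ∀ a → adj H a a ≡ false
    looplessH zero    = refl
    looplessH (suc a) = cong (λ e → e ∧ not (isUV a a)) (loopless a)

  new-u : Edge H zero (suc u)
  new-u with u ≟ u
  ... | yes _  = refl
  ... | no u≢u = contradiction refl u≢u

  new-v : Edge H zero (suc v)
  new-v with v ≟ v
  ... | yes _  = ∨-zeroʳ _
  ... | no v≢v = contradiction refl v≢v

  new-edges : ∀ {x z} → Ends x z → Edge H zero (suc x) × Edge H zero (suc z)
  new-edges u-v = new-u , new-v
  new-edges v-u = new-v , new-u

  data Kind (x z : Fin n) : Set where
    split : Ends x z → Kind x z
    kept  : Edge H (suc x) (suc z) → Kind x z

  classify : ∀ {x z} → Edge G x z → Kind x z
  classify {x} {z} e with isUV x z in eq
  ... | true  = split (isUV⇒Ends x z eq)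
  ... | false = kept (cong₂ (λ e s → e ∧ not s) e eq)

  liftEdge : ∀ {x z y} → Kind x z → Walk H (suc z) (suc y) → Walk H (suc x) (suc y)
  liftEdge (split xz) q = cons {w = zero} (proj₁ (new-edges xz)) (cons (proj₂ (new-edges xz)) q)
  liftEdge (kept e)   q = cons e q

  lift : ∀ {x y} → Walk G x y → Walk H (suc x) (suc y)
  lift nil        = nil
  lift (cons e p) = liftEdge (classify e) (lift p)

  ∈-lift⁻ : ∀ {x y a} (p : Walk G x y) → suc a ∈ vertices (lift p) → a ∈ vertices p
  ∈-lift⁻ nil (here refl) = here refl
  ∈-lift⁻ (cons e p) a∈ with classify e | a∈
  ... | split _ | here refl             = here refl
  ... | split _ | there (there a∈lift)  = there (∈-lift⁻ p a∈lift)
  ... | kept _  | here refl             = here refl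
  ... | kept _  | there a∈lift          = there (∈-lift⁻ p a∈lift)

  new∈lift⁻ : ∀ {x y} (p : Walk G x y) → zero ∈ vertices (lift p) → u ∈ vertices p × v ∈ vertices p
  new∈lift⁻ nil (here ())
  new∈lift⁻ (cons e p) new∈ with classify e | new∈
  ... | split u-v | there (here refl)    = here refl , there (source∈vertices p)
  ... | split v-u | there (here refl)    = there (source∈vertices p) , here refl
  ... | split _   | there (there new∈′)  = Product.map there there (new∈lift⁻ p new∈′)
  ... | kept _    | there new∈′          = Product.map there there (new∈lift⁻ p new∈′)

  lift-fresh : ∀ {x y a} (p : Walk G x y) → All (a ≢_) (vertices p) → All (suc a ≢_) (vertices (lift p))
  lift-fresh p a∉ = All.tabulate λ { b∈ refl → All.lookup a∉ (∈-lift⁻ p b∈) refl }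

  new-fresh : ∀ {x y s s′} (p : Walk G x y) → Ends s s′ → All (s ≢_) (vertices p) →
              All (zero ≢_) (vertices (lift p))
  new-fresh p u-v u∉ = All.tabulate λ { b∈ refl → All.lookup u∉ (proj₁ (new∈lift⁻ p b∈)) refl }
  new-fresh p v-u v∉ = All.tabulate λ { b∈ refl → All.lookup v∉ (proj₂ (new∈lift⁻ p b∈)) refl }

  lift-isPath : ∀ {x y} (p : Walk G x y) → IsPath p → IsPath (lift p)
  lift-isPath nil        _              = [] ∷ []
  lift-isPath (cons e p) (x∉ ∷ isPath) with classify e
  ... | split xz = ((λ ()) ∷ lift-fresh p x∉) ∷ new-fresh p xz x∉ ∷ lift-isPath p isPath
  ... | kept _   = lift-fresh p x∉ ∷ lift-isPath p isPath

  module _ {c} (col : EdgeColouring n c) (col-sym : IsSymColouring col) where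

    colouring : EdgeColouring (suc n) c
    colouring (suc a) (suc b) = col a b
    colouring _       _       = col u v

    colouring-sym : IsSymColouring colouring
    colouring-sym zero    zero    = refl
    colouring-sym zero    (suc b) = refl
    colouring-sym (suc a) zero    = refl
    colouring-sym (suc a) (suc b) = col-sym a b

    Ends⇒colour : ∀ {x z} → Ends x z → col x z ≡ col u v
    Ends⇒colour u-v = refl
    Ends⇒colour v-u = col-sym v u

    lift-edgeColours : ∀ {x y} (p : Walk G x y) → edgeColours col p ⊆ edgeColours colouring (lift p)
    lift-edgeColours (cons e p) κ∈ with classify e | κ∈
    ... | split xz | here refl = here (Ends⇒colour xz)
    ... | split _  | there κ∈′ = there (there (lift-edgeColours p κ∈′))
    ... | kept _   | here refl = here refl
    ... | kept _   | there κ∈′ = there (lift-edgeColours p κ∈′)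

    lift-kColouredPath : ∀ {k x y} → KColouredPath k G col x y → KColouredPath k H colouring (suc x) (suc y)
    lift-kColouredPath (p , isPath , atLeast) =
      lift p , lift-isPath p isPath , atLeastColours-⊆ (lift-edgeColours p) atLeast

    -- If the path starts along the subdivided edge, that edge is replaced by its half at the other
    -- end; otherwise the half-edge to s is prepended.
    new-kColouredPath : ∀ {k s s′ t} → Ends s s′ → s ≢ t → KColouredPath k G col s t →
                        KColouredPath k H colouring zero (suc t)
    new-kColouredPath _ s≢t (nil , _) = contradiction refl s≢t
    new-kColouredPath ss′ _ (cons e p , s∉ ∷ isPath , atLeast) with classify e
    ... | split sz =
      cons (proj₂ (new-edges sz)) (lift p) ,
      new-fresh p ss′ s∉ ∷ lift-isPath p isPath ,
      atLeastColours-⊆ (λ { (here refl) → here (Ends⇒colour sz) ; (there κ∈) → there (lift-edgeColours p κ∈) }) atLeast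
    ... | kept e′ =
      cons (proj₁ (new-edges ss′)) (cons e′ (lift p)) ,
      ((λ ()) ∷ new-fresh p ss′ s∉) ∷ lift-fresh p s∉ ∷ lift-isPath p isPath ,
      atLeastColours-⊆ (λ { (here refl) → there (here refl) ; (there κ∈) → there (there (lift-edgeColours p κ∈)) }) atLeast

    kColouredPath-from-new : ∀ {k} → IsSimple G → Edge G u v → KColourConnecting k G col →
                             ∀ t → KColouredPath k H colouring zero (suc t)
    kColouredPath-from-new simple uv kcc t with t ≟ u
    ... | no t≢u   = new-kColouredPath u-v (t≢u ∘ sym) (kcc u t (t≢u ∘ sym))
    ... | yes refl = new-kColouredPath v-u v≢u (kcc v u v≢u)
      where
      v≢u : v ≢ u
      v≢u = ≢-sym (edge⇒≢ simple uv)

    kColourConnecting : ∀ {k} → IsSimple G → Edge G u v → KColourConnecting k G col →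
                        KColourConnecting k H colouring
    kColourConnecting _      _  _   zero    zero    0≢0 = contradiction refl 0≢0
    kColourConnecting _      _  kcc (suc a) (suc b) a≢b = lift-kColouredPath (kcc a b (a≢b ∘ cong suc))
    kColourConnecting simple uv kcc zero    (suc t) _   = kColouredPath-from-new simple uv kcc t
    kColourConnecting simple uv kcc (suc t) zero    _   =
      reverse-kColouredPath colouring colouring-sym (kColouredPath-from-new simple uv kcc t)
      where open Reverse (proj₁ (isSimple simple))

subdivide-hasKCC : ∀ {k n c} {G : Graph n} {u v} → IsSimple G → Edge G u v →
                   HasKCC k G c → HasKCC k (subdivide G u v) c
subdivide-hasKCC {G = G} {u} {v} simple uv (col , col-sym , kcc) =
  colouring col col-sym , colouring-sym col col-sym , kColourConnecting col col-sym simple uv kcc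
  where open Subdivide G u v

subdivision-isSimple : ∀ {n m} {G : Graph n} {H : Graph m} → Subdivision G H → IsSimple G → IsSimple H
subdivision-isSimple here                       simple = simple
subdivision-isSimple (step {H = H} G⇝H u v _) simple = Subdivide.isSimple H u v (subdivision-isSimple G⇝H simple)

subdivision-hasKCC : ∀ {k n m c} {G : Graph n} {H : Graph m} → Subdivision G H → IsSimple G →
                     HasKCC k G c → HasKCC k H c
subdivision-hasKCC here              simple kcc = kcc
subdivision-hasKCC (step G⇝H u v uv) simple kcc =
  subdivide-hasKCC (subdivision-isSimple G⇝H simple) uv (subdivision-hasKCC G⇝H simple kcc)

∈-─⁺ : ∀ {A : Set} {x y : A} {ys} (x∈ys : x ∈ ys) → y ∈ ys → y ≢ x → y ∈ ys ─ x∈ys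
∈-─⁺ (here refl) (here refl) y≢x = contradiction refl y≢x
∈-─⁺ (here refl) (there y∈) _    = y∈
∈-─⁺ (there x∈)  (here refl) _   = here refl
∈-─⁺ (there x∈)  (there y∈) y≢x  = there (∈-─⁺ x∈ y∈ y≢x)

unique∧⊆⇒length≤ : ∀ {A : Set} {xs ys : List A} → Unique xs → xs ⊆ ys → length xs ≤ length ys
unique∧⊆⇒length≤ {xs = []}            _             _     = z≤n
unique∧⊆⇒length≤ {xs = x ∷ xs} {ys} (x∉ ∷ unique) xs⊆ys =
  subst (suc (length xs) ≤_) (sym (length-removeAt′ ys (index x∈ys)))
    (s≤s (unique∧⊆⇒length≤ unique λ y∈ → ∈-─⁺ x∈ys (xs⊆ys (there y∈)) λ { refl → All.lookup x∉ y∈ refl }))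
  where
  x∈ys : x ∈ ys
  x∈ys = xs⊆ys (here refl)

atLeastColours? : ∀ {c} k (xs : List (Fin c)) → Dec (AtLeastColours k xs)
atLeastColours? k xs = map′
  (λ k≤ → distinct , UniqueDecₚ.deduplicate-! _≟_ xs , k≤ , All.tabulate (∈-deduplicate⁻ _≟_ xs))
  (λ { (S , unique , k≤ , S⊆xs) → ≤-trans k≤ (unique∧⊆⇒length≤ unique (∈-deduplicate⁺ _≟_ ∘ All.lookup S⊆xs)) })
  (k ≤? length distinct)
  where
  distinct = deduplicate _≟_ xs

Σ-dec : ∀ {A : Set} {B : A → Set} → Irrelevant A → Dec A → (∀ x → Dec (B x)) → Dec (Σ A B)
Σ-dec A-irr (yes x) B? = map′ (x ,_) (λ { (x′ , b) → subst _ (A-irr x′ x) b }) (B? x)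
Σ-dec A-irr (no ¬x) B? = no (¬x ∘ proj₁)

module _ {N} (K : Graph N) where

  walkLength : ∀ {a b} → Walk K a b → ℕ
  walkLength nil        = 0
  walkLength (cons _ p) = suc (walkLength p)

  length-vertices : ∀ {a b} (p : Walk K a b) → length (vertices p) ≡ suc (walkLength p)
  length-vertices nil        = refl
  length-vertices (cons _ p) = cong suc (length-vertices p)

  path⇒walkLength< : ∀ {a b} (p : Walk K a b) → IsPath p → walkLength p < N
  path⇒walkLength< p isPath = subst₂ _≤_ (length-vertices p) (length-tabulate id)
    (unique∧⊆⇒length≤ isPath (λ {y} _ → ∈-allFin y))

  ShortWalk : ℕ → (a b : Fin N) → (Walk K a b → Set) → Set
  ShortWalk L a b Q = Σ (Walk K a b) λ p → walkLength p ≤ L × Q p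

  shortWalk? : ∀ L a b (Q : Walk K a b → Set) → (∀ p → Dec (Q p)) → Dec (ShortWalk L a b Q)
  shortWalk? zero a b Q Q? with a ≟ b
  ... | no a≢b   = no λ { (nil , _) → a≢b refl ; (cons _ _ , () , _) }
  ... | yes refl = map′ (λ q → nil , z≤n , q) (λ { (nil , _ , q) → q ; (cons _ _ , () , _) }) (Q? nil)
  shortWalk? (suc L) a b Q Q? = map′
    (λ { (inj₁ (p , ℓ≤0 , q)) → p , ≤-trans ℓ≤0 z≤n , q ; (inj₂ (w , e , p , ℓ≤ , q)) → cons e p , s≤s ℓ≤ , q })
    (λ { (nil , _ , q) → inj₁ (nil , z≤n , q) ; (cons e p , s≤s ℓ≤ , q) → inj₂ (_ , e , p , ℓ≤ , q) })
    (shortWalk? zero a b Q Q? ⊎-dec any? λ w →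
      Σ-dec (Decidable⇒UIP.≡-irrelevant Bool._≟_) (adj K a w Bool.≟ true) λ e →
        shortWalk? L w b (Q ∘ cons e) (Q? ∘ cons e))

  kColouredPath? : ∀ {c} k (col : EdgeColouring N c) a b → Dec (KColouredPath k K col a b)
  kColouredPath? k col a b = map′
    (λ (p , _ , q) → p , q)
    (λ (p , q) → p , <⇒≤ (path⇒walkLength< p (proj₁ q)) , q)
    (shortWalk? N a b _ λ p → UniqueDec.unique? _≟_ (vertices p) ×-dec atLeastColours? k (edgeColours col p))

-- Exhaustive search up to an equivalence: the notion needed to search a function space without
-- function extensionality.
Searchable : (A : Set) → (A → A → Set) → Set₁
Searchable A _≈_ = ∀ {P : A → Set} → (∀ {x y} → x ≈ y → P x → P y) → (∀ x → Dec (P x)) → Dec (Σ A P)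

Fin-searchable : ∀ {c} → Searchable (Fin c) _≡_
Fin-searchable _ P? = any? P?

Vector-searchable : ∀ {A : Set} {_≈_ : A → A → Set} → (∀ x → x ≈ x) → Searchable A _≈_ →
                    ∀ m → Searchable (Fin m → A) (λ f g → ∀ i → f i ≈ g i)
Vector-searchable refl≈ search zero    P-resp P? =
  map′ (_ ,_) (λ (f , Pf) → P-resp (λ ()) Pf) (P? λ ())
Vector-searchable refl≈ search (suc m) P-resp P? = map′
  (λ (x , f , P[x∷f]) → x ∷ᵛ f , P[x∷f])
  (λ (f , Pf) → head f , tail f , P-resp (λ { zero → refl≈ (head f) ; (suc i) → refl≈ (f (suc i)) }) Pf)
  (search
    (λ x≈y (f , P[x∷f]) → f , P-resp (λ { zero → x≈y ; (suc i) → refl≈ (f i) }) P[x∷f])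
    (λ x → Vector-searchable refl≈ search m
      (λ f≈g → P-resp λ { zero → refl≈ x ; (suc i) → f≈g i })
      (λ f → P? (x ∷ᵛ f))))

EdgeColouring-searchable : ∀ {n c} → Searchable (EdgeColouring n c) (λ f g → ∀ a b → f a b ≡ g a b)
EdgeColouring-searchable {n} = Vector-searchable (λ _ _ → refl) (Vector-searchable (λ _ → refl) Fin-searchable n) n

edgeColours-cong : ∀ {n c} {G : Graph n} {f g : EdgeColouring n c} → (∀ a b → f a b ≡ g a b) →
                   ∀ {a b} (p : Walk G a b) → edgeColours f p ≡ edgeColours g p
edgeColours-cong f≗g nil        = refl
edgeColours-cong f≗g (cons _ p) = cong₂ _∷_ (f≗g _ _) (edgeColours-cong f≗g p)

hasKCC? : ∀ {n} k (G : Graph n) c → Dec (HasKCC k G c)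
hasKCC? k G c = EdgeColouring-searchable respects λ col →
  (all? λ a → all? λ b → col a b ≟ col b a) ×-dec
  (all? λ a → all? λ b → ¬? (a ≟ b) →-dec kColouredPath? G k col a b)
  where
  respects : ∀ {f g} → (∀ a b → f a b ≡ g a b) →
             IsSymColouring f × KColourConnecting k G f → IsSymColouring g × KColourConnecting k G g
  respects f≗g (f-sym , f-kcc) =
    (λ a b → trans (sym (f≗g a b)) (trans (f-sym a b) (f≗g b a))) ,
    λ a b a≢b → let (p , isPath , atLeast) = f-kcc a b a≢b in
      p , isPath , subst (AtLeastColours k) (edgeColours-cong f≗g p) atLeast

module _ {P : ℕ → Set} (P? : ∀ n → Dec (P n)) where

  least-below : ∀ n → (Σ ℕ λ j → j < n × P j × (∀ {i} → i < j → ¬ P i)) ⊎ (∀ {i} → i < n → ¬ P i)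
  least-below zero = inj₂ λ ()
  least-below (suc n) with least-below n
  ... | inj₁ (j , j<n , Pj , least) = inj₁ (j , m<n⇒m<1+n j<n , Pj , least)
  ... | inj₂ none with P? n
  ...   | yes Pn = inj₁ (n , n<1+n n , Pn , none)
  ...   | no ¬Pn = inj₂ λ i<1+n → [ none , (λ { refl → ¬Pn }) ]′ (m<1+n⇒m<n∨m≡n i<1+n)

  least-≤ : ∀ {m} → P m → Σ ℕ λ j → (P j × (∀ i → P i → j ≤ i)) × j ≤ m
  least-≤ {m} Pm with least-below (suc m)
  ... | inj₁ (j , j<1+m , Pj , least) = j , (Pj , λ i Pi → ≮⇒≥ λ i<j → least i<j Pi) , m<1+n⇒m≤n j<1+m
  ... | inj₂ none = contradiction Pm (none (n<1+n m))

theorem2p2 : (k : ℕ) → 2 ≤ k → {n : ℕ} (G : Graph n) → IsSimple G → Connected G →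
    (m : ℕ) → IsCCk k G m → {n' : ℕ} (H : Graph n') → Subdivision G H →
    Σ ℕ λ m' → IsCCk k H m' × m' ≤ m
theorem2p2 k _ G simple _ m (G-kcc , _) H G⇝H =
  least-≤ (hasKCC? k H) (subdivision-hasKCC G⇝H simple G-kcc)
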